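{- For all non-negative integers $n$ and $k$, $$\sum_{j=0}^n\binom{n}{j}(-1)^jp^{n-j}W_{j+k}=(-q)^nW_{ -n+k}.$$
   Context: Let $H$ be the real quaternion algebra with basis $1,i,j,k$ and (non-commutative) multiplication determined by $i^2=j^2=k^2=-1$, $ij=-ji=k$, $jk=-kj=i$, $ki=-ik=j$; real scalars commute with all quaternions. Fix real numbers $p,q$ with $q\neq0$. The Horadam sequence $w_n=w_n(w_0,w_1;p,q)$ has real initial values $w_0,w_1$ and satisfies $w_n=pw_{n-1}+qw_{n-2}$ for $n\ge 2$; it is extended to all negative indices by running the recurrence backwards (equivalently $(-q)^n w_{ -n}=w_0u_{n+1}-w_1u_n$ for $n\ge0$, where $u_n=w_n(0,1;p,q)$). The Horadam quaternions are $W_n=w_n+w_{n+1}i+w_{n+2}j+w_{n+3}k$ for all integers $n$. -}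

module Defs where

open import Level using (Level)
open import Data.Nat as ℕ using (ℕ; zero; suc)
open import Data.Nat.Combinatorics using (_C_)
open import Data.Integer as ℤ using (ℤ; +_; -[1+_])
open import Data.Product using (_×_; _,_; proj₁; proj₂)
open import Algebra.Bundles using (CommutativeRing)

module Horadam {c ℓ : Level} (R : CommutativeRing c ℓ) where
  open CommutativeRing R

  fromℕ : ℕ → Carrier
  fromℕ zero    = 0#
  fromℕ (suc n) = 1# + fromℕ n

  pow : Carrier → ℕ → Carrier
  pow x zero    = 1#
  pow x (suc n) = x * pow x n

  sumTo : ℕ → (ℕ → Carrier) → Carrier
  sumTo zero    f = f 0
  sumTo (suc n) f = sumTo n f + f (suc n)

  -- Parameters of the Horadam sequence: p, q, an inverse qi of q, w₀, w₁.
  module Seq (p q qi w₀ w₁ : Carrier) where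

    fwd : ℕ → Carrier × Carrier
    fwd zero    = w₀ , w₁
    fwd (suc n) = proj₂ (fwd n) , p * proj₂ (fwd n) + q * proj₁ (fwd n)

    -- (w_{-m} , w_{-m+1}) for m ≥ 0 by running the recurrence backwards:
    -- w_{t-2} = q⁻¹ (w_t - p w_{t-1})
    bwd : ℕ → Carrier × Carrier
    bwd zero    = w₀ , w₁
    bwd (suc m) = qi * (proj₂ (bwd m) - p * proj₁ (bwd m)) , proj₁ (bwd m)

    w : ℤ → Carrier
    w (+ n)     = proj₁ (fwd n)
    w -[1+ m ]  = proj₁ (bwd (suc m))

  record Quat : Set c where
    constructor quat
    field
      re ii jj kk : Carrier
  open Quat public

  _≈Q_ : Quat → Quat → Set ℓ
  x ≈Q y = (re x ≈ re y) × (ii x ≈ ii y) × (jj x ≈ jj y) × (kk x ≈ kk y)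

  _+Q_ : Quat → Quat → Quat
  x +Q y = quat (re x + re y) (ii x + ii y) (jj x + jj y) (kk x + kk y)

  _·Q_ : Carrier → Quat → Quat
  a ·Q x = quat (a * re x) (a * ii x) (a * jj x) (a * kk x)

  -- Hamilton product (i² = j² = k² = -1, ij = k, jk = i, ki = j)
  _*Q_ : Quat → Quat → Quat
  x *Q y = quat
    (re x * re y - ii x * ii y - jj x * jj y - kk x * kk y)
    (re x * ii y + ii x * re y + jj x * kk y - kk x * jj y)
    (re x * jj y - ii x * kk y + jj x * re y + kk x * ii y)
    (re x * kk y + ii x * jj y - jj x * ii y + kk x * re y)

  0Q : Quat
  0Q = quat 0# 0# 0# 0#

  sumQ : ℕ → (ℕ → Quat) → Quat
  sumQ zero    f = f 0
  sumQ (suc n) f = sumQ n f +Q f (suc n)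

  HQ : (p q qi w₀ w₁ : Carrier) → ℤ → Quat
  HQ p q qi w₀ w₁ n =
    quat (w n) (w (n ℤ.+ ℤ.+ 1)) (w (n ℤ.+ ℤ.+ 2)) (w (n ℤ.+ ℤ.+ 3))
    where open Seq p q qi w₀ w₁

module Submission where

-- The identity is linear in W and quaternion sums are computed componentwise, so it
-- suffices to prove it for every component t ↦ w_{t+c}.  Each component f satisfies the
-- two-sided Horadam recurrence f(t+1) = p f(t) + q f(t-1) on all of ℤ, which rearranges
-- to the "reflected" form  p f(t) + s f(t+1) = Q f(t-1)  with s = -1, Q = -q.
--
-- The core is a statement about binomial sums over an arbitrary commutative ring: writing
--   B_n(g) = Σ_{j=0}^{n} C(n,j) s^j p^(n-j) g(j),
-- Pascal's rule gives  B_{n+1}(g) = p B_n(g) + s B_n(g ∘ suc),  and by induction on n every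
-- f with p f(t) + s f(t+1) = Q f(t-1) satisfies  B_n(j ↦ f(j+m)) = Q^n f(m-n).

open import Defs
open import Level using (Level)
open import Data.Nat as ℕ using (ℕ; _∸_; zero; suc)
open import Data.Nat.Combinatorics using (_C_; nCk+nC[k+1]≡[n+1]C[k+1]; k>n⇒nCk≡0)
import Data.Nat.Properties as ℕP
open import Data.Integer as ℤ using (ℤ; +_; -[1+_])
import Data.Integer.Tactic.RingSolver as ℤSolver
open import Data.Product using (_,_; proj₁)
open import Algebra.Bundles using (CommutativeRing)
open import Relation.Binary.PropositionalEquality as Eq using (_≡_)

module IndexArithmetic where
  suc-shift : ∀ j m → (+ 1 ℤ.+ j) ℤ.+ m ≡ j ℤ.+ (m ℤ.+ + 1)
  suc-shift = ℤSolver.solve-∀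

  neg-shift-up : ∀ n m → ℤ.- n ℤ.+ (m ℤ.+ + 1) ≡ (ℤ.- n ℤ.+ m) ℤ.+ + 1
  neg-shift-up = ℤSolver.solve-∀

  neg-shift-down : ∀ n m → (ℤ.- n ℤ.- + 1) ℤ.+ m ≡ (ℤ.- n ℤ.+ m) ℤ.- + 1
  neg-shift-down = ℤSolver.solve-∀

  succ-comm : ∀ t c → (t ℤ.+ + 1) ℤ.+ c ≡ (t ℤ.+ c) ℤ.+ + 1
  succ-comm = ℤSolver.solve-∀

  pred-comm : ∀ t c → (t ℤ.- + 1) ℤ.+ c ≡ (t ℤ.+ c) ℤ.- + 1
  pred-comm = ℤSolver.solve-∀

  -- -(n+1) = -n - 1 on the nose (needed because -[1+ n] is a normal form).
  neg-suc : ∀ n → ℤ.- (+ suc n) ≡ ℤ.- (+ n) ℤ.- + 1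
  neg-suc zero    = Eq.refl
  neg-suc (suc n) = Eq.cong (λ x → -[1+ suc x ]) (Eq.sym (ℕP.+-identityʳ n))

  neg-suc-shift : ∀ n m → ℤ.- (+ suc n) ℤ.+ m ≡ (ℤ.- (+ n) ℤ.+ m) ℤ.- + 1
  neg-suc-shift n m = Eq.trans (Eq.cong (ℤ._+ m) (neg-suc n)) (neg-shift-down (+ n) m)

open IndexArithmetic

module Development {c ℓ : Level} (R : CommutativeRing c ℓ) where
  open CommutativeRing R
  open Horadam R
  open import Relation.Binary.Reasoning.Setoid setoid
  open import Algebra.Solver.Ring.NaturalCoefficients.Default commutativeSemiring
    using (solve; _:+_; _:*_; _:=_)
  open import Algebra.Properties.Ring ring using (-1*x≈-x; -‿distribˡ-*)
  open import Algebra.Properties.AbelianGroup +-abelianGroup using (⁻¹-∙-comm)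
  open import Algebra.Properties.Group +-group using (//-rightDividesˡ)

  ≡⇒≈ : ∀ {x y} → x ≡ y → x ≈ y
  ≡⇒≈ Eq.refl = refl

  fromℕ-+ : ∀ a b → fromℕ (a ℕ.+ b) ≈ fromℕ a + fromℕ b
  fromℕ-+ zero    b = sym (+-identityˡ _)
  fromℕ-+ (suc a) b = trans (+-congˡ (fromℕ-+ a b)) (sym (+-assoc _ _ _))

  add-sub-cancel : ∀ a x → a + (x - a) ≈ x
  add-sub-cancel a x = trans (+-comm a (x - a)) (//-rightDividesˡ a x)

  add-neg-sum : ∀ a b → a + - (a + b) ≈ - b
  add-neg-sum a b = begin
    a + - (a + b)    ≈⟨ +-congˡ (sym (⁻¹-∙-comm a b)) ⟩
    a + (- a + - b)  ≈⟨ sym (+-assoc _ _ _) ⟩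
    (a + - a) + - b  ≈⟨ +-congʳ (-‿inverseʳ a) ⟩
    0# + - b         ≈⟨ +-identityˡ _ ⟩
    - b              ∎

  sumTo-cong : ∀ n {f g : ℕ → Carrier} → (∀ j → f j ≈ g j) → sumTo n f ≈ sumTo n g
  sumTo-cong zero    f≈g = f≈g 0
  sumTo-cong (suc n) f≈g = +-cong (sumTo-cong n f≈g) (f≈g (suc n))

  sum-pascal : ∀ (p s : Carrier) N (b c g : ℕ → Carrier) →
    b 0 ≈ p * c 0 → (∀ j → b (suc j) ≈ p * c (suc j) + s * c j) →
    sumTo (suc N) (λ j → b j * g j)
      ≈ p * sumTo (suc N) (λ j → c j * g j) + s * sumTo N (λ j → c j * g (suc j))
  sum-pascal p s zero b c g b₀ bₛ =
    trans (+-cong (*-congʳ b₀) (*-congʳ (bₛ 0))) (regroup _ _ _ _ _ _)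
    where
    regroup : ∀ p s c₀ c₁ g₀ g₁ →
      p * c₀ * g₀ + (p * c₁ + s * c₀) * g₁ ≈ p * (c₀ * g₀ + c₁ * g₁) + s * (c₀ * g₁)
    regroup = solve 6 (λ p s c₀ c₁ g₀ g₁ →
      p :* c₀ :* g₀ :+ (p :* c₁ :+ s :* c₀) :* g₁ := p :* (c₀ :* g₀ :+ c₁ :* g₁) :+ s :* (c₀ :* g₁)) refl
  sum-pascal p s (suc N) b c g b₀ bₛ =
    trans (+-cong (sum-pascal p s N b c g b₀ bₛ) (*-congʳ (bₛ (suc N)))) (regroup _ _ _ _ _ _ _)
    where
    regroup : ∀ p s A B c₁ c₂ g₂ →
      (p * A + s * B) + (p * c₂ + s * c₁) * g₂ ≈ p * (A + c₂ * g₂) + s * (B + c₁ * g₂)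
    regroup = solve 7 (λ p s A B c₁ c₂ g₂ →
      (p :* A :+ s :* B) :+ (p :* c₂ :+ s :* c₁) :* g₂ := p :* (A :+ c₂ :* g₂) :+ s :* (B :+ c₁ :* g₂)) refl

  module Binomial (p s : Carrier) where
    coeff : ℕ → ℕ → Carrier
    coeff n j = fromℕ (n C j) * pow s j * pow p (n ∸ j)

    -- the weight C(n,n+1)·… vanishes, so B_n may be read as a sum up to n+1
    coeff-beyond : ∀ n → coeff n (suc n) ≈ 0#
    coeff-beyond n = begin
      fromℕ (n C suc n) * pow s (suc n) * pow p (n ∸ suc n)
        ≈⟨ *-congʳ (*-congʳ (≡⇒≈ (Eq.cong fromℕ (k>n⇒nCk≡0 (ℕP.n<1+n n))))) ⟩
      0# * pow s (suc n) * pow p (n ∸ suc n)  ≈⟨ *-congʳ (zeroˡ _) ⟩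
      0# * pow p (n ∸ suc n)                  ≈⟨ zeroˡ _ ⟩
      0#                                       ∎

    -- Pascal's rule at j = 0 (both binomial coefficients are 1)
    coeff-pascal-zero : ∀ n → coeff (suc n) 0 ≈ p * coeff n 0
    coeff-pascal-zero n = pull-out _ _ _ _
      where
      pull-out : ∀ c e p x → c * e * (p * x) ≈ p * (c * e * x)
      pull-out = solve 4 (λ c e p x → c :* e :* (p :* x) := p :* (c :* e :* x)) refl

    -- One factor p can be pulled out of p^(n-j) whenever C(n,j+1) ≠ 0, i.e. j < n;
    -- otherwise both sides vanish.
    pascal-power : ∀ n j →
      fromℕ (n C suc j) * pow p (n ∸ j) ≈ p * (fromℕ (n C suc j) * pow p (n ∸ suc j))
    pascal-power n j with n ∸ j in n∸j≡
    ... | zero = begin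
      fromℕ (n C suc j) * 1#               ≈⟨ *-congʳ vanish ⟩
      0# * 1#                              ≈⟨ zeroˡ _ ⟩
      0#                                   ≈⟨ sym (zeroʳ p) ⟩
      p * 0#                               ≈⟨ *-congˡ (sym (zeroˡ _)) ⟩
      p * (0# * pow p (n ∸ suc j))         ≈⟨ *-congˡ (*-congʳ (sym vanish)) ⟩
      p * (fromℕ (n C suc j) * pow p (n ∸ suc j)) ∎
      where
      vanish : fromℕ (n C suc j) ≈ 0#
      vanish = ≡⇒≈ (Eq.cong fromℕ (k>n⇒nCk≡0 {n} {suc j} (ℕ.s≤s (ℕP.m∸n≡0⇒m≤n {n} {j} n∸j≡))))
    ... | suc d = begin
      fromℕ (n C suc j) * (p * pow p d)    ≈⟨ swap _ _ _ ⟩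
      p * (fromℕ (n C suc j) * pow p d)    ≈⟨ *-congˡ (*-congˡ (≡⇒≈ (Eq.cong (pow p) (Eq.sym n∸sj≡d)))) ⟩
      p * (fromℕ (n C suc j) * pow p (n ∸ suc j)) ∎
      where
      n∸sj≡d : n ∸ suc j ≡ d
      n∸sj≡d = Eq.trans (Eq.sym (ℕP.pred[m∸n]≡m∸[1+n] n j)) (Eq.cong ℕ.pred n∸j≡)
      swap : ∀ x p y → x * (p * y) ≈ p * (x * y)
      swap = solve 3 (λ x p y → x :* (p :* y) := p :* (x :* y)) refl

    coeff-pascal : ∀ n j → coeff (suc n) (suc j) ≈ p * coeff n (suc j) + s * coeff n j
    coeff-pascal n j = begin
      fromℕ (suc n C suc j) * (s * pow s j) * pow p (n ∸ j)
        ≈⟨ *-congʳ (*-congʳ (trans (≡⇒≈ (Eq.cong fromℕ (Eq.sym (nCk+nC[k+1]≡[n+1]C[k+1] n j))))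
                                   (fromℕ-+ (n C j) _))) ⟩
      (X + Y) * (s * S) * pow p (n ∸ j)
        ≈⟨ split _ _ _ _ _ ⟩
      (s * S) * (Y * pow p (n ∸ j)) + s * coeff n j
        ≈⟨ +-congʳ (*-congˡ (pascal-power n j)) ⟩
      (s * S) * (p * (Y * pow p (n ∸ suc j))) + s * coeff n j
        ≈⟨ +-congʳ (rearrange _ _ _ _) ⟩
      p * coeff n (suc j) + s * coeff n j ∎
      where
      X = fromℕ (n C j)
      Y = fromℕ (n C suc j)
      S = pow s j
      split : ∀ X Y s S P → (X + Y) * (s * S) * P ≈ (s * S) * (Y * P) + s * (X * S * P)
      split = solve 5 (λ X Y s S P →
        (X :+ Y) :* (s :* S) :* P := (s :* S) :* (Y :* P) :+ s :* (X :* S :* P)) refl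
      rearrange : ∀ sS p Y P → (sS * (p * (Y * P))) ≈ p * (Y * sS * P)
      rearrange = solve 4 (λ sS p Y P → sS :* (p :* (Y :* P)) := p :* (Y :* sS :* P)) refl

    binomSum : ℕ → (ℕ → Carrier) → Carrier
    binomSum n g = sumTo n (λ j → coeff n j * g j)

    binomSum-step : ∀ n g → binomSum (suc n) g ≈ p * binomSum n g + s * binomSum n (λ j → g (suc j))
    binomSum-step n g = begin
      binomSum (suc n) g
        ≈⟨ sum-pascal p s n (coeff (suc n)) (coeff n) g (coeff-pascal-zero n) (coeff-pascal n) ⟩
      p * (binomSum n g + coeff n (suc n) * g (suc n)) + s * binomSum n (λ j → g (suc j))
        ≈⟨ +-congʳ (*-congˡ (+-congˡ (trans (*-congʳ (coeff-beyond n)) (zeroˡ _)))) ⟩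
      p * (binomSum n g + 0#) + s * binomSum n (λ j → g (suc j))
        ≈⟨ +-congʳ (*-congˡ (+-identityʳ _)) ⟩
      p * binomSum n g + s * binomSum n (λ j → g (suc j)) ∎

    binomSum-reflect : ∀ (Q : Carrier) (f : ℤ → Carrier) →
      (∀ t → p * f t + s * f (t ℤ.+ + 1) ≈ Q * f (t ℤ.- + 1)) →
      ∀ n m → binomSum n (λ j → f (+ j ℤ.+ m)) ≈ pow Q n * f (ℤ.- (+ n) ℤ.+ m)
    binomSum-reflect Q f reflected zero m =
      *-congʳ (trans (*-identityʳ _) (trans (*-identityʳ _) (+-identityʳ _)))
    binomSum-reflect Q f reflected (suc n) m = begin
      binomSum (suc n) (λ j → f (+ j ℤ.+ m))
        ≈⟨ binomSum-step n _ ⟩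
      p * binomSum n (λ j → f (+ j ℤ.+ m)) + s * binomSum n (λ j → f (+ suc j ℤ.+ m))
        ≈⟨ +-congˡ (*-congˡ (sumTo-cong n (λ j → *-congˡ (≡⇒≈ (Eq.cong f (suc-shift (+ j) m)))))) ⟩
      p * binomSum n (λ j → f (+ j ℤ.+ m)) + s * binomSum n (λ j → f (+ j ℤ.+ (m ℤ.+ + 1)))
        ≈⟨ +-cong (*-congˡ (binomSum-reflect Q f reflected n m))
                  (*-congˡ (binomSum-reflect Q f reflected n (m ℤ.+ + 1))) ⟩
      p * (Qⁿ * f t) + s * (Qⁿ * f (ℤ.- (+ n) ℤ.+ (m ℤ.+ + 1)))
        ≈⟨ +-congˡ (*-congˡ (*-congˡ (≡⇒≈ (Eq.cong f (neg-shift-up (+ n) m))))) ⟩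
      p * (Qⁿ * f t) + s * (Qⁿ * f (t ℤ.+ + 1))
        ≈⟨ factor _ _ _ _ _ ⟩
      Qⁿ * (p * f t + s * f (t ℤ.+ + 1))
        ≈⟨ *-congˡ (reflected t) ⟩
      Qⁿ * (Q * f (t ℤ.- + 1))
        ≈⟨ reassoc _ _ _ ⟩
      (Q * Qⁿ) * f (t ℤ.- + 1)
        ≈⟨ *-congˡ (≡⇒≈ (Eq.cong f (Eq.sym (neg-suc-shift n m)))) ⟩
      pow Q (suc n) * f (ℤ.- (+ suc n) ℤ.+ m) ∎
      where
      t = ℤ.- (+ n) ℤ.+ m
      Qⁿ = pow Q n
      factor : ∀ p s c x y → p * (c * x) + s * (c * y) ≈ c * (p * x + s * y)
      factor = solve 5 (λ p s c x y → p :* (c :* x) :+ s :* (c :* y) := c :* (p :* x :+ s :* y)) refl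
      reassoc : ∀ c Q z → c * (Q * z) ≈ (Q * c) * z
      reassoc = solve 3 (λ c Q z → c :* (Q :* z) := (Q :* c) :* z) refl

  Recurrence : Carrier → Carrier → (ℤ → Carrier) → Set ℓ
  Recurrence p q f = ∀ t → f (t ℤ.+ + 1) ≈ p * f t + q * f (t ℤ.- + 1)

  recurrence-shift : ∀ {p q f} → Recurrence p q f → ∀ c → Recurrence p q (λ t → f (t ℤ.+ c))
  recurrence-shift {p} {q} {f} rec c t = begin
    f ((t ℤ.+ + 1) ℤ.+ c)                  ≈⟨ ≡⇒≈ (Eq.cong f (succ-comm t c)) ⟩
    f ((t ℤ.+ c) ℤ.+ + 1)                  ≈⟨ rec (t ℤ.+ c) ⟩
    p * f (t ℤ.+ c) + q * f ((t ℤ.+ c) ℤ.- + 1) ≈⟨ +-congˡ (*-congˡ (≡⇒≈ (Eq.cong f (Eq.sym (pred-comm t c))))) ⟩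
    p * f (t ℤ.+ c) + q * f ((t ℤ.- + 1) ℤ.+ c) ∎

  recurrence-reflected : ∀ {p q f} → Recurrence p q f →
    ∀ t → p * f t + (- 1#) * f (t ℤ.+ + 1) ≈ (- q) * f (t ℤ.- + 1)
  recurrence-reflected {p} {q} {f} rec t = begin
    p * f t + (- 1#) * f (t ℤ.+ + 1)           ≈⟨ +-congˡ (-1*x≈-x _) ⟩
    p * f t + - f (t ℤ.+ + 1)                  ≈⟨ +-congˡ (-‿cong (rec t)) ⟩
    p * f t + - (p * f t + q * f (t ℤ.- + 1))  ≈⟨ add-neg-sum _ _ ⟩
    - (q * f (t ℤ.- + 1))                      ≈⟨ -‿distribˡ-* _ _ ⟩
    (- q) * f (t ℤ.- + 1)                      ∎

  horadam-recurrence : ∀ p q qi w₀ w₁ → q * qi ≈ 1# → Recurrence p q (Seq.w p q qi w₀ w₁)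
  horadam-recurrence p q qi w₀ w₁ q*qi≈1 = recurrence
    where
    open Seq p q qi w₀ w₁
    -- one backward step followed by one forward step is the identity
    forward-backward : ∀ x z → x ≈ p * z + q * (qi * (x - p * z))
    forward-backward x z = sym (begin
      p * z + q * (qi * (x - p * z))  ≈⟨ +-congˡ (sym (*-assoc _ _ _)) ⟩
      p * z + (q * qi) * (x - p * z)  ≈⟨ +-congˡ (*-congʳ q*qi≈1) ⟩
      p * z + 1# * (x - p * z)        ≈⟨ +-congˡ (*-identityˡ _) ⟩
      p * z + (x - p * z)             ≈⟨ add-sub-cancel _ _ ⟩
      x                               ∎)
    recurrence : Recurrence p q w
    recurrence (+ zero)        = forward-backward w₁ w₀
    recurrence (+ suc k)       = ≡⇒≈ (Eq.cong (λ x → w (+ x)) (ℕP.+-comm (suc k) 1))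
    recurrence -[1+ zero ]     = forward-backward _ _
    recurrence -[1+ suc m ]    = trans (forward-backward _ _) (+-congˡ (*-congˡ (≡⇒≈
      (Eq.cong (λ x → proj₁ (bwd (suc (suc x)))) (Eq.sym (ℕP.+-identityʳ (suc m)))))))

  sumQ-component : (π : Quat → Carrier) → (∀ x y → π (x +Q y) ≡ π x + π y) →
                   ∀ n (F : ℕ → Quat) → π (sumQ n F) ≡ sumTo n (λ j → π (F j))
  sumQ-component π additive zero    F = Eq.refl
  sumQ-component π additive (suc n) F =
    Eq.trans (additive (sumQ n F) (F (suc n))) (Eq.cong (_+ π (F (suc n))) (sumQ-component π additive n F))

  sumQ-≈Q : ∀ n (F : ℕ → Quat) X →
    sumTo n (λ j → re (F j)) ≈ re X → sumTo n (λ j → ii (F j)) ≈ ii X →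
    sumTo n (λ j → jj (F j)) ≈ jj X → sumTo n (λ j → kk (F j)) ≈ kk X → sumQ n F ≈Q X
  sumQ-≈Q n F X r i j k =
      trans (≡⇒≈ (sumQ-component re (λ _ _ → Eq.refl) n F)) r
    , trans (≡⇒≈ (sumQ-component ii (λ _ _ → Eq.refl) n F)) i
    , trans (≡⇒≈ (sumQ-component jj (λ _ _ → Eq.refl) n F)) j
    , trans (≡⇒≈ (sumQ-component kk (λ _ _ → Eq.refl) n F)) k

  binomial-reflection : ∀ {p q f} → Recurrence p q f → ∀ n k →
    Binomial.binomSum p (- 1#) n (λ j → f (+ j ℤ.+ + k)) ≈ pow (- q) n * f (ℤ.- (+ n) ℤ.+ + k)
  binomial-reflection {p} {q} {f} rec n k =
    Binomial.binomSum-reflect p (- 1#) (- q) f (recurrence-reflected rec) n (+ k)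

theorem3p2 : ∀ {c ℓ : Level} (R : CommutativeRing c ℓ) →
    let open CommutativeRing R
        open Horadam R
    in (p q qi w₀ w₁ : Carrier) → q * qi ≈ 1# → (n k : ℕ) →
       sumQ n (λ j → (fromℕ (n C j) * pow (- 1#) j * pow p (n ∸ j))
                       ·Q HQ p q qi w₀ w₁ (+ j ℤ.+ + k))
         ≈Q (pow (- q) n ·Q HQ p q qi w₀ w₁ (ℤ.- (+ n) ℤ.+ + k))
theorem3p2 R p q qi w₀ w₁ q*qi≈1 n k =
  sumQ-≈Q n _ _ (binomial-reflection rec n k)
                (binomial-reflection (recurrence-shift rec (+ 1)) n k)
                (binomial-reflection (recurrence-shift rec (+ 2)) n k)
                (binomial-reflection (recurrence-shift rec (+ 3)) n k)
  where
  open Development R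
  rec : Recurrence p q (Horadam.Seq.w R p q qi w₀ w₁)
  rec = horadam-recurrence p q qi w₀ w₁ q*qi≈1
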